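{- Let $T$ be a string of length $n \geq 1$, let $b$ be a character with $b \neq T[1]$, and let $T' = b\,T[2..n]$. Then $G(T) \leq 1$, where $G(T) = \sum_{y \in \mathsf{M}(T) \cap \mathsf{M}(T')} \max\{0, d_{T'}(y) - d_T(y)\}$ is the total number of new outgoing edges in $\mathrm{CDAWG}(T')$ of nodes that already exist in $\mathrm{CDAWG}(T)$.
   Context: Strings are finite sequences of characters from an alphabet $\Sigma$; $\varepsilon$ is the empty string, $T[i]$ the $i$-th character, $T[i..j]=T[i]\cdots T[j]$. For a string $T$, $\mathrm{Substr}(T)$ is its set of substrings (including $\varepsilon$). A substring $u$ of $T$ is left-maximal in $T$ if $u$ is a prefix of $T$ or there are distinct characters $c \neq d$ with $cu, du \in \mathrm{Substr}(T)$; it is right-maximal in $T$ if $u$ is a suffix of $T$ or there are distinct characters $c\neq d$ with $uc, ud \in \mathrm{Substr}(T)$. $\mathsf{M}(T)$ is the set of substrings of $T$ that are both left- and right-maximal; these are the nodes of the CDAWG of $T$. For a string $w$, $d_T(w)$ is the number of distinct characters $c$ with $wc \in \mathrm{Substr}(T)$ (for $w\in\mathsf{M}(T)$, the out-degree of $w$ in the CDAWG of $T$). -}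

module Defs where

open import Level using (Level)
open import Data.Nat using (ℕ)
open import Data.Product using (∃; ∃₂; _×_)
open import Data.Sum using (_⊎_)
open import Data.List using (List; []; _∷_; _++_; [_]; length; filter; deduplicate)
open import Data.List.Relation.Binary.Infix.Heterogeneous using (Infix)
open import Data.List.Relation.Binary.Infix.Heterogeneous.Properties using (infix?)
open import Relation.Binary.Definitions using (DecidableEquality)
open import Relation.Binary.PropositionalEquality using (_≡_; _≢_)

module Strings {A : Set} (_≟_ : DecidableEquality A) where

  Substr : List A → List A → Set
  Substr u T = Infix _≡_ u T

  IsPrefix : List A → List A → Set
  IsPrefix u T = ∃ λ ys → u ++ ys ≡ T

  IsSuffix : List A → List A → Set
  IsSuffix u T = ∃ λ xs → xs ++ u ≡ T

  LeftMaximal : List A → List A → Set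
  LeftMaximal T u = IsPrefix u T
    ⊎ (∃₂ λ c d → c ≢ d × Substr (c ∷ u) T × Substr (d ∷ u) T)

  RightMaximal : List A → List A → Set
  RightMaximal T u = IsSuffix u T
    ⊎ (∃₂ λ c d → c ≢ d × Substr (u ++ [ c ]) T × Substr (u ++ [ d ]) T)

  InM : List A → List A → Set
  InM T u = Substr u T × LeftMaximal T u × RightMaximal T u

  -- d_T(w): number of distinct characters c with w c ∈ Substr(T).
  -- Any such c occurs in T, so we count over the distinct characters of T.
  d : List A → List A → ℕ
  d T w = length (filter (λ c → infix? _≟_ (w ++ [ c ]) T) (deduplicate _≟_ T))

-- A character c is a new extension of y if y c occurs in T' but not in T.  Since T and T'
-- differ only in their first character, every new occurrence is a prefix of T'.  If y and
-- y' are both substrings of T with new extensions y c and y' c', these are prefixes of T',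
-- hence one is a prefix of the other; a proper prefix would be a prefix of y or y' and so
-- would occur in T.  Hence y = y' and c = c': only one substring of T gains an out-edge,
-- and it gains only one.
module Submission where

open import Defs
open import Data.Nat using (ℕ; suc; _≤_; _<_; _∸_; _+_; z≤n; s≤s; _<?_)
open import Data.Nat.Properties
  using (<⇒≢; ≤-trans; ≤-reflexive; ∸-monoˡ-≤; m+n∸n≡m; m≤n⇒m∸n≡0; n≤0⇒n≡0; ≮⇒≥; +-identityʳ)
open import Data.Nat.ListAction using (sum)
open import Data.Product using (_×_; _,_; ∃; proj₁; proj₂)
open import Data.Sum using (_⊎_; inj₁; inj₂)
open import Data.Empty using (⊥-elim)
open import Data.List using (List; []; _∷_; map; _∷ʳ_; length; filter; deduplicate)
open import Data.List.Properties using (length-removeAt′)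
open import Data.List.Membership.Propositional using (_∈_; find; lose)
open import Data.List.Membership.Propositional.Properties using (∈-filter⁺; ∈-filter⁻; ∈-deduplicate⁺)
open import Data.List.Relation.Binary.Subset.Propositional using (_⊆_)
open import Data.List.Relation.Unary.Any using (here; there; _─_; any?)
import Data.List.Relation.Unary.All as All
open import Data.List.Relation.Unary.AllPairs using (_∷_)
open import Data.List.Relation.Unary.Unique.Propositional using (Unique)
open import Data.List.Relation.Unary.Unique.Propositional.Properties using (filter⁺)
open import Data.List.Relation.Unary.Unique.DecPropositional.Properties using (deduplicate-!)
open import Data.List.Relation.Binary.Prefix.Heterogeneous using (Prefix; []; _∷_)
open import Data.List.Relation.Binary.Infix.Heterogeneous using (Infix; here; there)
open import Data.List.Relation.Binary.Infix.Heterogeneous.Properties using (infix?; ∷⁻; Prefix-Infix-trans)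
open import Function.Base using (_∘_)
open import Function.Bundles using (_⇔_; Equivalence)
open import Relation.Nullary using (¬_; yes; no)
open import Relation.Nullary.Decidable using (¬?)
open import Relation.Binary.Definitions using (DecidableEquality)
open import Relation.Binary.PropositionalEquality using (_≡_; _≢_; refl; sym; trans; subst)

module _ {A : Set} where

  ∈-─ : ∀ {x y : A} {zs} (x∈zs : x ∈ zs) → y ∈ zs → y ≢ x → y ∈ (zs ─ x∈zs)
  ∈-─ (here refl) (here refl) y≢x = ⊥-elim (y≢x refl)
  ∈-─ (here _)    (there y∈)  _   = y∈
  ∈-─ (there _)   (here y≡z)  _   = here y≡z
  ∈-─ (there x∈)  (there y∈)  y≢x = there (∈-─ x∈ y∈ y≢x)

  Unique-⊆⇒length≤ : ∀ {xs zs : List A} → Unique xs → xs ⊆ zs → length xs ≤ length zs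
  Unique-⊆⇒length≤ {[]}     _            _    = z≤n
  Unique-⊆⇒length≤ {x ∷ xs} {zs} (x∉xs ∷ u) x∷xs⊆zs =
    subst (suc (length xs) ≤_) (sym (length-removeAt′ zs _))
      (s≤s (Unique-⊆⇒length≤ u xs⊆zs─x))
    where
    x∈zs : x ∈ zs
    x∈zs = x∷xs⊆zs (here refl)
    xs⊆zs─x : xs ⊆ (zs ─ x∈zs)
    xs⊆zs─x y∈xs = ∈-─ x∈zs (x∷xs⊆zs (there y∈xs)) (λ y≡x → All.lookup x∉xs y∈xs (sym y≡x))

  Prefix-∷ʳ⇒∈ : ∀ {xs ys : List A} {x} → Prefix _≡_ (xs ∷ʳ x) ys → x ∈ ys
  Prefix-∷ʳ⇒∈ {[]}     (refl ∷ _) = here refl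
  Prefix-∷ʳ⇒∈ {_ ∷ xs} (refl ∷ p) = there (Prefix-∷ʳ⇒∈ {xs} p)

  Infix-∷ʳ⇒∈ : ∀ {xs ys : List A} {x} → Infix _≡_ (xs ∷ʳ x) ys → x ∈ ys
  Infix-∷ʳ⇒∈ (here p)  = Prefix-∷ʳ⇒∈ p
  Infix-∷ʳ⇒∈ (there i) = there (Infix-∷ʳ⇒∈ i)

  Prefix-comparable : ∀ {us vs ws : List A} →
    Prefix _≡_ us ws → Prefix _≡_ vs ws → Prefix _≡_ us vs ⊎ Prefix _≡_ vs us
  Prefix-comparable []         _          = inj₁ []
  Prefix-comparable (_ ∷ _)    []         = inj₂ []
  Prefix-comparable (refl ∷ p) (refl ∷ q) with Prefix-comparable p q
  ... | inj₁ r = inj₁ (refl ∷ r)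
  ... | inj₂ r = inj₂ (refl ∷ r)

  Prefix-∷ʳ⁻ : ∀ (us vs : List A) {u v} →
    Prefix _≡_ (us ∷ʳ u) (vs ∷ʳ v) → Prefix _≡_ (us ∷ʳ u) vs ⊎ (us ≡ vs × u ≡ v)
  Prefix-∷ʳ⁻ []          []       (refl ∷ _) = inj₂ (refl , refl)
  Prefix-∷ʳ⁻ []          (_ ∷ _)  (refl ∷ _) = inj₁ (refl ∷ [])
  Prefix-∷ʳ⁻ (_ ∷ [])    []       (_ ∷ ())
  Prefix-∷ʳ⁻ (_ ∷ _ ∷ _) []       (_ ∷ ())
  Prefix-∷ʳ⁻ (_ ∷ us)    (_ ∷ vs) (refl ∷ p) with Prefix-∷ʳ⁻ us vs p
  ... | inj₁ r           = inj₁ (refl ∷ r)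
  ... | inj₂ (refl , eq) = inj₂ (refl , eq)

module _ {B : Set} (f : B → ℕ) where

  sum-map-≡0 : ∀ xs → (∀ {x} → x ∈ xs → f x ≡ 0) → sum (map f xs) ≡ 0
  sum-map-≡0 []       _    = refl
  sum-map-≡0 (x ∷ xs) f≡0 rewrite f≡0 (here refl) = sum-map-≡0 xs (f≡0 ∘ there)

  sum-map-≤1 : ∀ {xs : List B} → Unique xs →
    (∀ {x} → x ∈ xs → f x ≤ 1) →
    (∀ {x y} → x ∈ xs → y ∈ xs → 0 < f x → 0 < f y → x ≡ y) →
    sum (map f xs) ≤ 1
  sum-map-≤1 {[]}     _          _   _         = z≤n
  sum-map-≤1 {x ∷ xs} (x∉xs ∷ u) f≤1 positive≡ with 0 <? f x
  ... | no  f≯0 = subst (λ n → n + sum (map f xs) ≤ 1) (sym (n≤0⇒n≡0 (≮⇒≥ f≯0)))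
                    (sum-map-≤1 u (f≤1 ∘ there) (λ p q → positive≡ (there p) (there q)))
  ... | yes f>0 = subst (λ n → f x + n ≤ 1) (sym (sum-map-≡0 xs rest-zero))
                    (subst (_≤ 1) (sym (+-identityʳ (f x))) (f≤1 (here refl)))
    where
    rest-zero : ∀ {y} → y ∈ xs → f y ≡ 0
    rest-zero {y} y∈xs with 0 <? f y
    ... | yes f>0′ = ⊥-elim (All.lookup x∉xs y∈xs (positive≡ (here refl) (there y∈xs) f>0 f>0′))
    ... | no  f≯0′ = n≤0⇒n≡0 (≮⇒≥ f≯0′)

module Extensions {A : Set} (_≟_ : DecidableEquality A) where
  open Strings _≟_

  extensions : List A → List A → List A
  extensions T w = filter (λ c → infix? _≟_ (w ∷ʳ c) T) (deduplicate _≟_ T)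

  ∈-extensions⁺ : ∀ {T w c} → Substr (w ∷ʳ c) T → c ∈ extensions T w
  ∈-extensions⁺ {T} {w} wc∈T =
    ∈-filter⁺ (λ c → infix? _≟_ (w ∷ʳ c) T) (∈-deduplicate⁺ _≟_ (Infix-∷ʳ⇒∈ wc∈T)) wc∈T

  ∈-extensions⁻ : ∀ {T w c} → c ∈ extensions T w → Substr (w ∷ʳ c) T
  ∈-extensions⁻ {T} {w} c∈ext =
    proj₂ (∈-filter⁻ (λ c → infix? _≟_ (w ∷ʳ c) T) {xs = deduplicate _≟_ T} c∈ext)

  d≤length : ∀ {T w} {cs : List A} → (∀ {c} → Substr (w ∷ʳ c) T → c ∈ cs) → d T w ≤ length cs
  d≤length {T} {w} ext⊆cs = Unique-⊆⇒length≤
    (filter⁺ (λ c → infix? _≟_ (w ∷ʳ c) T) (deduplicate-! _≟_ T))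
    (ext⊆cs ∘ ∈-extensions⁻)

  NewExtension : List A → List A → List A → A → Set
  NewExtension T T′ w c = Substr (w ∷ʳ c) T′ × ¬ Substr (w ∷ʳ c) T

  new-extension-or-d≤ : ∀ T T′ w → ∃ (NewExtension T T′ w) ⊎ d T′ w ≤ d T w
  new-extension-or-d≤ T T′ w with any? (λ c → ¬? (infix? _≟_ (w ∷ʳ c) T)) (extensions T′ w)
  ... | yes new = let c , c∈ext , wc∉T = find new in inj₁ (c , ∈-extensions⁻ c∈ext , wc∉T)
  ... | no ¬new = inj₂ (d≤length old)
    where
    old : ∀ {c} → Substr (w ∷ʳ c) T′ → c ∈ extensions T w
    old {c} wc∈T′ with infix? _≟_ (w ∷ʳ c) T
    ... | yes wc∈T = ∈-extensions⁺ wc∈T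
    ... | no  wc∉T = ⊥-elim (¬new (lose (∈-extensions⁺ wc∈T′) wc∉T))

module FirstCharacterChange {A : Set} (_≟_ : DecidableEquality A) (t b : A) (s : List A) where
  open Strings _≟_
  open Extensions _≟_

  T T′ : List A
  T  = t ∷ s
  T′ = b ∷ s

  New : List A → A → Set
  New = NewExtension T T′

  new⇒prefix : ∀ {w c} → New w c → Prefix _≡_ (w ∷ʳ c) T′
  new⇒prefix (wc∈T′ , wc∉T) with ∷⁻ wc∈T′
  ... | inj₁ prefix = prefix
  ... | inj₂ wc∈s   = ⊥-elim (wc∉T (there wc∈s))

  new-extensions-coincide : ∀ {w₁ w₂ c₁ c₂} → Substr w₁ T → Substr w₂ T →
    New w₁ c₁ → New w₂ c₂ → w₁ ≡ w₂ × c₁ ≡ c₂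
  new-extensions-coincide {w₁} {w₂} w₁∈T w₂∈T new₁ new₂
    with Prefix-comparable (new⇒prefix new₁) (new⇒prefix new₂)
  ... | inj₁ p₁₂ with Prefix-∷ʳ⁻ w₁ w₂ p₁₂
  ...   | inj₁ w₁c₁⊑w₂ = ⊥-elim (proj₂ new₁ (Prefix-Infix-trans trans w₁c₁⊑w₂ w₂∈T))
  ...   | inj₂ eqs     = eqs
  new-extensions-coincide {w₁} {w₂} w₁∈T w₂∈T new₁ new₂ | inj₂ p₂₁ with Prefix-∷ʳ⁻ w₂ w₁ p₂₁
  ...   | inj₁ w₂c₂⊑w₁     = ⊥-elim (proj₂ new₂ (Prefix-Infix-trans trans w₂c₂⊑w₁ w₁∈T))
  ...   | inj₂ (eq₁ , eq₂) = sym eq₁ , sym eq₂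

  d≤suc : ∀ {w c} → Substr w T → New w c → d T′ w ≤ suc (d T w)
  d≤suc {w} {c} w∈T new = d≤length old-or-c
    where
    old-or-c : ∀ {c′} → Substr (w ∷ʳ c′) T′ → c′ ∈ c ∷ extensions T w
    old-or-c {c′} wc′∈T′ with infix? _≟_ (w ∷ʳ c′) T
    ... | yes wc′∈T = there (∈-extensions⁺ wc′∈T)
    ... | no  wc′∉T = here (proj₂ (new-extensions-coincide w∈T w∈T (wc′∈T′ , wc′∉T) new))

  excess : List A → ℕ
  excess w = d T′ w ∸ d T w

  excess≤1 : ∀ {w} → Substr w T → excess w ≤ 1
  excess≤1 {w} w∈T with new-extension-or-d≤ T T′ w
  ... | inj₁ (c , new) = ≤-trans (∸-monoˡ-≤ (d T w) (d≤suc w∈T new)) (≤-reflexive (m+n∸n≡m 1 (d T w)))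
  ... | inj₂ d′≤d      = ≤-trans (≤-reflexive (m≤n⇒m∸n≡0 d′≤d)) z≤n

  excess⇒new : ∀ {w} → 0 < excess w → ∃ (New w)
  excess⇒new {w} 0<excess with new-extension-or-d≤ T T′ w
  ... | inj₁ new  = new
  ... | inj₂ d′≤d = ⊥-elim (<⇒≢ 0<excess (sym (m≤n⇒m∸n≡0 d′≤d)))

lemma11 : {A : Set} (_≟_ : DecidableEquality A) (t b : A) (s : List A) →
    b ≢ t →
    (ys : List (List A)) → Unique ys →
    (∀ y → (y ∈ ys) ⇔ (Strings.InM _≟_ (t ∷ s) y × Strings.InM _≟_ (b ∷ s) y)) →
    sum (map (λ y → Strings.d _≟_ (b ∷ s) y ∸ Strings.d _≟_ (t ∷ s) y) ys) ≤ 1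
lemma11 _≟_ t b s _ ys unique ys≡M∩M′ = sum-map-≤1 excess unique (excess≤1 ∘ substr) at-most-one
  where
  open FirstCharacterChange _≟_ t b s
  substr : ∀ {y} → y ∈ ys → Strings.Substr _≟_ y T
  substr {y} y∈ys = proj₁ (proj₁ (Equivalence.to (ys≡M∩M′ y) y∈ys))
  at-most-one : ∀ {x y} → x ∈ ys → y ∈ ys → 0 < excess x → 0 < excess y → x ≡ y
  at-most-one x∈ y∈ x⁺ y⁺ =
    proj₁ (new-extensions-coincide (substr x∈) (substr y∈) (proj₂ (excess⇒new x⁺)) (proj₂ (excess⇒new y⁺)))
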